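{- Let $(E,+,{}',0,1)$ be an effect algebra with induced order $\leq$ and let $a,b\in E$. Then \[ L(a,b)=(a'+(a'+L(a,b))')' \quad\text{and}\quad U(a,b)=a+(a+(U(a,b))')'. \]
   Context: An effect algebra is a partial algebra $(E,+,{}',0,1)$ of type $(2,1,0,0)$ where $+$ is a partial binary operation such that for all $x,y,z\in E$: (E1) $x+y$ is defined iff $y+x$ is defined, and then $x+y=y+x$; (E2) $(x+y)+z$ is defined iff $x+(y+z)$ is defined, and then they are equal; (E3) $x'$ is the unique $u\in E$ with $x+u=1$; (E4) if $1+x$ is defined then $x=0$. The induced order is $x\leq y$ iff $x+z=y$ for some $z\in E$; it makes $E$ a bounded poset, and $x+y$ is defined iff $x\leq y'$. For $A\subseteq E$, $L(A)=\{x\in E\mid x\leq y \text{ for all } y\in A\}$ and $U(A)=\{x\in E\mid y\leq x\text{ for all }y\in A\}$; $L(a,b)=L(\{a,b\})$, $U(a,b)=U(\{a,b\})$. For $A\subseteq E$, $A'=\{x'\mid x\in A\}$; for $x\in E$ with $y\leq x'$ for all $y\in A$, $x+A=\{x+y\mid y\in A\}$. -}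

module Defs where

open import Level using (Level; suc; _⊔_)
open import Data.Maybe using (Maybe; just; _>>=_)
open import Data.Product using (Σ; _×_; _,_)
open import Relation.Binary.PropositionalEquality using (_≡_)

-- The partial operation + is modelled
-- as a total function into Maybe: x ⊕ y ≡ just z means "x+y is defined
-- and equals z"; x ⊕ y ≡ nothing means "x+y is undefined".
record EffectAlgebra (c : Level) : Set (suc c) where
  infixl 6 _⊕_
  field
    Carrier : Set c
    _⊕_     : Carrier → Carrier → Maybe Carrier
    _′      : Carrier → Carrier
    𝟘       : Carrier
    𝟙       : Carrier
    E1 : ∀ x y → x ⊕ y ≡ y ⊕ x
    E2 : ∀ x y z → ((x ⊕ y) >>= λ s → s ⊕ z) ≡ ((y ⊕ z) >>= λ t → x ⊕ t)
    E3-exists : ∀ x → x ⊕ (x ′) ≡ just 𝟙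
    E3-unique : ∀ x u → x ⊕ u ≡ just 𝟙 → u ≡ x ′
    E4 : ∀ x s → 𝟙 ⊕ x ≡ just s → x ≡ 𝟘

  _≤_ : Carrier → Carrier → Set c
  x ≤ y = Σ Carrier λ z → x ⊕ z ≡ just y

  Subset : Set (suc c)
  Subset = Carrier → Set c

  Lo : Carrier → Carrier → Subset
  Lo a b x = (x ≤ a) × (x ≤ b)

  Up : Carrier → Carrier → Subset
  Up a b x = (a ≤ x) × (b ≤ x)

  _ᶜ : Subset → Subset
  (A ᶜ) w = Σ Carrier λ y → A y × (w ≡ y ′)

  _+ˢ_ : Carrier → Subset → Subset
  (x +ˢ A) w = Σ Carrier λ y → A y × (x ⊕ y ≡ just w)

  _≐_ : Subset → Subset → Set c
  A ≐ B = ∀ w → ((A w → B w) × (B w → A w))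

module Submission where

open import Level using (Level)
open import Data.Product using (_×_; Σ; _,_; ∃; proj₁; proj₂)
open import Data.Maybe using (Maybe; just; _>>=_)
open import Data.Maybe.Properties using (just-injective)
open import Relation.Binary.PropositionalEquality
open import Defs

-- The key identity is the complement swap p + x = t ⇒ p + t' = x', obtained from
-- (p + x) + t' = 1 by associativity and uniqueness of complements. It shows that
-- y ↦ (p + y')' undoes y ↦ p + y, so p + (p + A)' = A' whenever p + x is defined
-- on A; both identities then follow since A'' = A.

>>=-just : ∀ {c} {A B : Set c} (m : Maybe A) (f : A → Maybe B) {r : B} →
           (m >>= f) ≡ just r → Σ A λ s → (m ≡ just s) × (f s ≡ just r)
>>=-just (just s) f eq = s , refl , eq

module EffectAlgebraProperties {c : Level} (E : EffectAlgebra c) where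
  open EffectAlgebra E

  ′-involutive : ∀ x → (x ′) ′ ≡ x
  ′-involutive x = sym (E3-unique (x ′) x (trans (E1 (x ′) x) (E3-exists x)))

  ⊕-assocʳ : ∀ {x y z s r} → x ⊕ y ≡ just s → s ⊕ z ≡ just r →
             ∃ λ u → (y ⊕ z ≡ just u) × (x ⊕ u ≡ just r)
  ⊕-assocʳ {x} {y} {z} x⊕y s⊕z =
    >>=-just (y ⊕ z) (x ⊕_)
      (trans (sym (E2 x y z)) (trans (cong (_>>= _⊕ z) x⊕y) s⊕z))

  ⊕-assocˡ : ∀ {x y z u r} → y ⊕ z ≡ just u → x ⊕ u ≡ just r →
             ∃ λ s → (x ⊕ y ≡ just s) × (s ⊕ z ≡ just r)
  ⊕-assocˡ {x} {y} {z} y⊕z x⊕u =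
    >>=-just (x ⊕ y) (_⊕ z)
      (trans (E2 x y z) (trans (cong (_>>= x ⊕_) y⊕z) x⊕u))

  ⊕-complement-swap : ∀ {p x t} → p ⊕ x ≡ just t → p ⊕ (t ′) ≡ just (x ′)
  ⊕-complement-swap {p} {x} {t} p⊕x with ⊕-assocʳ p⊕x (E3-exists t)
  ... | u , x⊕t′ , p⊕u with ⊕-assocˡ (trans (E1 (t ′) x) x⊕t′) p⊕u
  ... | v , p⊕t′ , v⊕x = trans p⊕t′ (cong just (E3-unique x v (trans (E1 x v) v⊕x)))

  ≤⇒⊕′-defined : ∀ {x y} → x ≤ y → ∃ λ s → x ⊕ (y ′) ≡ just s
  ≤⇒⊕′-defined (z , x⊕z) = z ′ , ⊕-complement-swap x⊕z

  ≐-sym : ∀ {A B : Subset} → A ≐ B → B ≐ A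
  ≐-sym A≐B w = proj₂ (A≐B w) , proj₁ (A≐B w)

  ≐-trans : ∀ {A B C : Subset} → A ≐ B → B ≐ C → A ≐ C
  ≐-trans A≐B B≐C w = (λ a → proj₁ (B≐C w) (proj₁ (A≐B w) a))
                    , (λ c → proj₂ (A≐B w) (proj₂ (B≐C w) c))

  ᶜ-cong : ∀ {A B : Subset} → A ≐ B → (A ᶜ) ≐ (B ᶜ)
  ᶜ-cong A≐B w = (λ (y , Ay , w≡) → y , proj₁ (A≐B y) Ay , w≡)
               , (λ (y , By , w≡) → y , proj₂ (A≐B y) By , w≡)

  ᶜ-involutive : ∀ (A : Subset) → ((A ᶜ) ᶜ) ≐ A
  ᶜ-involutive A w =
      (λ (_ , (x , Ax , y≡) , w≡) →
         subst A (trans (sym (′-involutive x)) (trans (cong _′ (sym y≡)) (sym w≡))) Ax)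
    , (λ Aw → w ′ , (w , Aw , refl) , sym (′-involutive w))

  +ˢ-+ˢᶜ : ∀ p (A : Subset) → (∀ {x} → A x → ∃ λ t → p ⊕ x ≡ just t) →
           (p +ˢ ((p +ˢ A) ᶜ)) ≐ (A ᶜ)
  +ˢ-+ˢᶜ p A summable w = to , from
    where
    to : (p +ˢ ((p +ˢ A) ᶜ)) w → (A ᶜ) w
    to (s , (t , (x , Ax , p⊕x) , s≡) , p⊕s) =
      x , Ax , just-injective (trans (sym p⊕s) (trans (cong (p ⊕_) s≡) (⊕-complement-swap p⊕x)))
    from : (A ᶜ) w → (p +ˢ ((p +ˢ A) ᶜ)) w
    from (x , Ax , refl) with summable Ax
    ... | t , p⊕x = t ′ , (t , (x , Ax , p⊕x) , refl) , ⊕-complement-swap p⊕x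

  Lo-complement-sum : ∀ a b → Lo a b ≐ (((a ′) +ˢ (((a ′) +ˢ Lo a b) ᶜ)) ᶜ)
  Lo-complement-sum a b =
    ≐-trans (≐-sym (ᶜ-involutive (Lo a b))) (ᶜ-cong (≐-sym (+ˢ-+ˢᶜ (a ′) (Lo a b) summable)))
    where
    summable : ∀ {x} → Lo a b x → ∃ λ t → (a ′) ⊕ x ≡ just t
    summable {x} (x≤a , _) with ≤⇒⊕′-defined x≤a
    ... | t , x⊕a′ = t , trans (E1 (a ′) x) x⊕a′

  Up-complement-sum : ∀ a b → Up a b ≐ (a +ˢ ((a +ˢ (Up a b ᶜ)) ᶜ))
  Up-complement-sum a b =
    ≐-trans (≐-sym (ᶜ-involutive (Up a b))) (≐-sym (+ˢ-+ˢᶜ a (Up a b ᶜ) summable))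
    where
    summable : ∀ {y} → (Up a b ᶜ) y → ∃ λ t → a ⊕ y ≡ just t
    summable (x , (a≤x , _) , refl) = ≤⇒⊕′-defined a≤x

lemma3 : ∀ {c : Level} (E : EffectAlgebra c) (a b : EffectAlgebra.Carrier E) →
    let open EffectAlgebra E in
    (Lo a b ≐ (((a ′) +ˢ (((a ′) +ˢ Lo a b) ᶜ)) ᶜ)) × (Up a b ≐ (a +ˢ ((a +ˢ (Up a b ᶜ)) ᶜ)))
lemma3 E a b = Lo-complement-sum a b , Up-complement-sum a b
  where open EffectAlgebraProperties E
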